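{- Let $n \geq 2$. The genus of $K_n \times K_2$ is exactly $\frac{(n-2)(n-3)}{6}$ if and only if there exists a snug embedding of $K_n\times K_2$.
   Context: $K_n \times K_2$ is the $n$-prism: two copies of $K_n$ on vertex sets $\{(a,0)\}$ and $\{(a,1)\}$, $a\in\mathbb{Z}_n$, plus the $n$ matching edges $((a,0),(a,1))$. Embeddings are cellular embeddings in closed orientable surfaces; the genus of a graph is the minimum genus of an orientable surface into which it embeds. An embedding of $K_n\times K_2$ is called snug if every face whose boundary contains at least one matching edge is a quadrilateral (4-sided) and every other face is a triangle (3-sided). -}

module Defs where

open import Data.Nat using (ℕ; zero; suc; _+_; _*_; _≤_; _<_)
open import Data.Fin using (Fin; splitAt; _≟_)
open import Data.Bool using (Bool; true; false; not; if_then_else_; T)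
open import Data.Sum using (_⊎_; inj₁; inj₂)
open import Data.Product using (Σ; Σ-syntax; ∃; ∃-syntax; _×_; _,_; proj₁; proj₂)
open import Data.List using (List; map; allFin)
open import Data.Nat.ListAction using (sum)
open import Relation.Nullary using (¬_; yes; no)
open import Relation.Nullary.Decidable using (⌊_⌋)
open import Relation.Binary.PropositionalEquality using (_≡_)
open import Function using (_∘_)

-- Simple graphs on vertex set Fin N, given by a Boolean adjacency
-- relation (assumed symmetric and irreflexive, as it is for the prism).

record Graph : Set where
  field
    N   : ℕ
    adj : Fin N → Fin N → Bool
open Graph public

Dart : Graph → Set
Dart G = Σ[ u ∈ Fin (N G) ] Σ[ v ∈ Fin (N G) ] T (adj G u v)

tail : {G : Graph} → Dart G → Fin (N G)
tail (u , _ , _) = u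

head : {G : Graph} → Dart G → Fin (N G)
head (_ , v , _) = v

numDarts : Graph → ℕ
numDarts G = sum (map (λ u → sum (map (λ v → if adj G u v then 1 else 0)
                                       (allFin (N G))))
                      (allFin (N G)))

iterate : {A : Set} → (A → A) → ℕ → A → A
iterate f zero    x = x
iterate f (suc k) x = f (iterate f k x)

record SymGraph : Set where
  field
    graph : Graph
    sym   : ∀ u v → T (adj graph u v) → T (adj graph v u)
open SymGraph public

rev : (S : SymGraph) → Dart (graph S) → Dart (graph S)
rev S (u , v , p) = v , u , sym S u v p

-- Rotation systems (Heffter–Edmonds): combinatorial description of the
-- cellular embeddings of a connected graph in closed orientable surfaces.
-- ρ is a permutation of the darts that fixes tails and acts as a single
-- cycle on the darts leaving each vertex (the local rotation).

record RotationSystem (S : SymGraph) : Set where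
  field
    ρ         : Dart (graph S) → Dart (graph S)
    ρ⁻¹       : Dart (graph S) → Dart (graph S)
    ρ⁻¹∘ρ     : ∀ d → ρ⁻¹ (ρ d) ≡ d
    ρ∘ρ⁻¹     : ∀ d → ρ (ρ⁻¹ d) ≡ d
    ρ-tail    : ∀ d → tail {graph S} (ρ d) ≡ tail {graph S} d
    ρ-cyclic  : ∀ d d' → tail {graph S} d ≡ tail {graph S} d' →
                ∃[ k ] iterate ρ k d ≡ d'
open RotationSystem public

-- Face-tracing permutation: the faces of the embedding are its orbits.
faceStep : {S : SymGraph} → RotationSystem S → Dart (graph S) → Dart (graph S)
faceStep {S} R d = ρ R (rev S d)

SameFace : {S : SymGraph} → RotationSystem S → Dart (graph S) → Dart (graph S) → Set
SameFace R d d' = ∃[ k ] iterate (faceStep R) k d ≡ d'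

HasFaces : {S : SymGraph} → RotationSystem S → ℕ → Set
HasFaces {S} R F =
  Σ[ f ∈ (Dart (graph S) → Fin F) ]
    ((∀ i → ∃[ d ] f d ≡ i) ×
     (∀ d d' → (f d ≡ f d' → SameFace R d d') × (SameFace R d d' → f d ≡ f d')))

-- The embedding lies on the orientable surface of genus g (Euler's formula
-- V - E + F = 2 - 2g, multiplied by 2 to avoid halving the dart count:
-- 4g + 2V + 2F = 4 + 2E).
EmbeddingGenus : {S : SymGraph} → RotationSystem S → ℕ → Set
EmbeddingGenus {S} R g =
  ∃[ F ] (HasFaces R F ×
          4 * g + 2 * N (graph S) + 2 * F ≡ 4 + numDarts (graph S))

IsGenus : SymGraph → ℕ → Set
IsGenus S g =
  (Σ[ R ∈ RotationSystem S ] EmbeddingGenus R g) ×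
  (∀ (R : RotationSystem S) g' → EmbeddingGenus R g' → g ≤ g')

FaceSize : {S : SymGraph} → RotationSystem S → Dart (graph S) → ℕ → Set
FaceSize R d k =
  0 < k × iterate (faceStep R) k d ≡ d ×
  (∀ j → 0 < j → j < k → ¬ (iterate (faceStep R) j d ≡ d))

-- The prism K_n × K_2 on vertex set Fin (n + n):
-- vertex a (from splitAt) in the left part is (a,0), in the right part (a,1).

prismAdj : (n : ℕ) → Fin (n + n) → Fin (n + n) → Bool
prismAdj n x y with splitAt n x | splitAt n y
... | inj₁ a | inj₁ b = not ⌊ a ≟ b ⌋
... | inj₂ a | inj₂ b = not ⌊ a ≟ b ⌋
... | inj₁ a | inj₂ b = ⌊ a ≟ b ⌋
... | inj₂ a | inj₁ b = ⌊ a ≟ b ⌋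

isMatching : (n : ℕ) → Fin (n + n) → Fin (n + n) → Bool
isMatching n x y with splitAt n x | splitAt n y
... | inj₁ a | inj₁ b = false
... | inj₂ a | inj₂ b = false
... | inj₁ a | inj₂ b = ⌊ a ≟ b ⌋
... | inj₂ a | inj₁ b = ⌊ a ≟ b ⌋

private
  not-sym : ∀ {m} (a b : Fin m) → T (not ⌊ a ≟ b ⌋) → T (not ⌊ b ≟ a ⌋)
  not-sym a b p with a ≟ b | b ≟ a
  ... | _ | no _ = _
  ... | no a≢b | yes b≡a = a≢b (Relation.Binary.PropositionalEquality.sym b≡a)
  ... | yes _ | yes _ = p
  eq-sym : ∀ {m} (a b : Fin m) → T ⌊ a ≟ b ⌋ → T ⌊ b ≟ a ⌋
  eq-sym a b p with a ≟ b | b ≟ a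
  ... | _ | yes _ = _
  ... | yes a≡b | no b≢a = b≢a (Relation.Binary.PropositionalEquality.sym a≡b)
  ... | no _ | no _ = p

prismSym : (n : ℕ) → ∀ x y → T (prismAdj n x y) → T (prismAdj n y x)
prismSym n x y p with splitAt n x | splitAt n y
... | inj₁ a | inj₁ b = not-sym a b p
... | inj₂ a | inj₂ b = not-sym a b p
... | inj₁ a | inj₂ b = eq-sym a b p
... | inj₂ a | inj₁ b = eq-sym a b p

Prism : ℕ → SymGraph
Prism n = record { graph = record { N = n + n ; adj = prismAdj n }
                 ; sym = prismSym n }

FaceHasMatching : (n : ℕ) → RotationSystem (Prism n) → Dart (graph (Prism n)) → Set
FaceHasMatching n R d =
  ∃[ e ] (SameFace R d e × T (isMatching n (tail {graph (Prism n)} e) (head {graph (Prism n)} e)))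

Snug : (n : ℕ) → RotationSystem (Prism n) → Set
Snug n R = ∀ d → (FaceHasMatching n R d → FaceSize R d 4) ×
                 (¬ FaceHasMatching n R d → FaceSize R d 3)

-- Weight each dart 1 if it runs along a matching edge and 2 otherwise; the prism has 2n² darts of
-- total weight 2n(2n − 1). In every embedding each face weighs at least 6: faces have length at least
-- 3, a face walk never takes two matching edges in a row (it would turn back along the same edge),
-- and a closed face walk changes copies of Kₙ an even number of times, so a face through a matching
-- edge has length at least 4 and weight at least 1 + 2 + 3. Hence 6F ≤ 2n(2n − 1), which Euler's
-- formula turns into 6g ≥ (n − 2)(n − 3), with equality exactly when every face weighs 6, i.e. when
-- the embedding is snug. The faces of a snug embedding have length 3 or 4, so its face permutation
-- has period 12 and its faces can be counted; its genus is integral because 3 divides n(2n − 1).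

module Submission where

open import Defs
open import Data.Nat using (ℕ; _≤_; _*_; _∸_)
open import Data.Product using (Σ-syntax; ∃-syntax; _×_)
open import Function.Bundles using (_⇔_)
open import Relation.Binary.PropositionalEquality using (_≡_)

open import Data.Nat using (zero; suc; _+_; _<_; z≤n; s≤s; NonZero)
open import Data.Nat.DivMod using (_%_; _/_; m≡m%n+[m/n]*n; m%n<n)
open import Data.Nat.Divisibility using (_∣_; _∣?_; divides; ∣m+n∣m⇒∣n; m∣m*n)
open import Data.Nat.ListAction using (sum)
open import Data.Nat.Properties hiding (_≟_)
open import Data.Nat.Tactic.RingSolver using (solve-∀)
open import Algebra.Properties.CommutativeSemigroup +-commutativeSemigroup using (xy∙z≈xz∙y)
open import Algebra.Properties.CommutativeMonoid.Sum +-0-commutativeMonoid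
  using (sum-syntax; sum-cong-≗; sum-remove; ∑-distrib-+; ∑-comm) renaming (sum to ∑)
open import Data.Bool using (Bool; true; false; T; if_then_else_; not; _xor_)
open import Data.Bool.Properties using (T-irrelevant; xor-identityʳ; xor-assoc)
open import Data.Empty using (⊥-elim)
open import Data.Fin using (Fin; zero; suc; _≟_; toℕ; fromℕ<; splitAt; join; _↑ˡ_; _↑ʳ_)
open import Data.Fin.Properties
  using (punchInᵢ≢i; any?; toℕ-fromℕ<; splitAt-join; join-splitAt; splitAt-↑ˡ; splitAt-↑ʳ)
open import Data.List
  using (List; []; _∷_; map; tabulate; allFin; applyUpTo; lookup; length; deduplicate; concatMap)
open import Data.List.Properties using (map-tabulate)
open import Data.List.Membership.Propositional using (_∈_; _∉_; lose)
open import Data.List.Membership.Propositional.Properties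
  using (∈-applyUpTo⁺; ∈-lookup; ∈-concatMap⁺; ∈-allFin)
open import Data.List.Relation.Unary.All as All using (All; []; _∷_)
open import Data.List.Relation.Unary.All.Properties using (applyUpTo⁺₂)
import Data.List.Relation.Unary.AllPairs as AllPairs
open import Data.List.Relation.Unary.Any as Any using (Any; index; here; there)
open import Data.List.Relation.Unary.Any.Properties using (lookup-index; applyUpTo⁻)
import Data.List.Relation.Unary.Enumerates.Setoid as Enumerates
open import Data.List.Relation.Unary.Enumerates.Setoid.Properties using (deduplicate⁺)
open import Data.List.Relation.Unary.Unique.Propositional using (Unique)
open import Data.List.Relation.Unary.Unique.Propositional.Properties using (applyUpTo⁺₁)
import Data.List.Relation.Unary.Unique.Setoid as UniqueSetoid
open import Data.List.Relation.Unary.Unique.DecSetoid.Properties using (deduplicate-!)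
open import Data.Product using (_,_; proj₁; proj₂; ∃; uncurry)
open import Data.Product.Properties using (≡-dec)
open import Data.Sum using (_⊎_; inj₁; inj₂; [_,_]′)
open import Data.Vec.Functional using (removeAt)
open import Function using (_∘_)
open import Function.Bundles using (mk⇔; Equivalence)
open import Level using (0ℓ)
open import Relation.Binary.Bundles using (DecSetoid)
open import Relation.Binary.Definitions using (DecidableEquality)
open import Relation.Binary.PropositionalEquality
  using (refl; trans; cong; cong₂; subst; _≢_; module ≡-Reasoning)
import Relation.Binary.PropositionalEquality as ≡
open import Relation.Nullary using (¬_; Dec; yes; no; contradiction)
open import Relation.Nullary.Decidable
  using (⌊_⌋; T?; dec-true; dec-false; isYes≗does; toWitness; fromWitness; toWitnessFalse; decidable-stable)
import Relation.Nullary.Decidable as Dec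

⌊⌋-true : ∀ {A : Set} (a? : Dec A) → A → ⌊ a? ⌋ ≡ true
⌊⌋-true a? a = trans (isYes≗does a?) (dec-true a? a)

⌊⌋-false : ∀ {A : Set} (a? : Dec A) → ¬ A → ⌊ a? ⌋ ≡ false
⌊⌋-false a? ¬a = trans (isYes≗does a?) (dec-false a? ¬a)

∑-const : ∀ n c → ∑[ i < n ] c ≡ n * c
∑-const zero    c = refl
∑-const (suc n) c = cong (c +_) (∑-const n c)

∑-zero : ∀ {n} {f : Fin n → ℕ} → (∀ i → f i ≡ 0) → ∑ f ≡ 0
∑-zero {n} f≡0 = trans (sum-cong-≗ f≡0) (trans (∑-const n 0) (*-zeroʳ n))

∑-mono-≤ : ∀ {n} {f g : Fin n → ℕ} → (∀ i → f i ≤ g i) → ∑ f ≤ ∑ g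
∑-mono-≤ {zero}  f≤g = z≤n
∑-mono-≤ {suc n} f≤g = +-mono-≤ (f≤g zero) (∑-mono-≤ (f≤g ∘ suc))

∑-+ : ∀ m n (f : Fin (m + n) → ℕ) → ∑ f ≡ ∑[ i < m ] f (i ↑ˡ n) + ∑[ j < n ] f (m ↑ʳ j)
∑-+ zero    n f = refl
∑-+ (suc m) n f = trans (cong (f zero +_) (∑-+ m n (f ∘ suc))) (≡.sym (+-assoc (f zero) _ _))

∑-exchange : ∀ {n} (a : Fin n) {f g : Fin n → ℕ} →
             (∀ b → b ≢ a → f b ≡ g b) → ∑ f + g a ≡ f a + ∑ g
∑-exchange {suc n} a {f} {g} f≡g = begin
  ∑ f + g a                 ≡⟨ cong (_+ g a) (sum-remove f) ⟩
  f a + ∑ f′ + g a          ≡⟨ +-assoc (f a) _ _ ⟩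
  f a + (∑ f′ + g a)        ≡⟨ cong (f a +_) (+-comm (∑ f′) (g a)) ⟩
  f a + (g a + ∑ f′)        ≡⟨ cong (λ s → f a + (g a + s)) (sum-cong-≗ f′≗g′) ⟩
  f a + (g a + ∑ g′)        ≡⟨ cong (f a +_) (sum-remove g) ⟨
  f a + ∑ g                 ∎
  where
  open ≡-Reasoning
  f′ = removeAt f a
  g′ = removeAt g a
  f′≗g′ : ∀ j → f′ j ≡ g′ j
  f′≗g′ j = f≡g _ (punchInᵢ≢i a j)

∑-≟ : ∀ {n} (a : Fin n) (H : Bool → ℕ) →
      ∑[ b < n ] H ⌊ a ≟ b ⌋ + H false ≡ H true + n * H false
∑-≟ {n} a H = begin
  ∑[ b < n ] H ⌊ a ≟ b ⌋ + H false  ≡⟨ ∑-exchange a (λ b b≢a → cong H (⌊⌋-false (a ≟ b) (b≢a ∘ ≡.sym))) ⟩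
  H ⌊ a ≟ a ⌋ + ∑[ b < n ] H false  ≡⟨ cong₂ _+_ (cong H (⌊⌋-true (a ≟ a) refl)) (∑-const n (H false)) ⟩
  H true + n * H false              ∎
  where open ≡-Reasoning

∑-indicator : ∀ {n} (a : Fin n) c → ∑[ b < n ] (if ⌊ a ≟ b ⌋ then c else 0) ≡ c
∑-indicator {n} a c = begin
  ∑[ b < n ] (if ⌊ a ≟ b ⌋ then c else 0)      ≡⟨ +-identityʳ _ ⟨
  ∑[ b < n ] (if ⌊ a ≟ b ⌋ then c else 0) + 0  ≡⟨ ∑-≟ a (λ x → if x then c else 0) ⟩
  c + n * 0                                    ≡⟨ cong (c +_) (*-zeroʳ n) ⟩
  c + 0                                        ≡⟨ +-identityʳ c ⟩
  c                                            ∎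
  where open ≡-Reasoning

∑-tight : ∀ {n} (f : Fin n → ℕ) c → (∀ i → c ≤ f i) → ∑ f ≤ n * c → ∀ i → f i ≤ c
∑-tight {suc n} f c c≤f ∑f≤ zero =
  +-cancelʳ-≤ (n * c) (f zero) c (≤-trans (+-monoʳ-≤ (f zero) n*c≤∑) ∑f≤)
  where
  n*c≤∑ : n * c ≤ ∑ (f ∘ suc)
  n*c≤∑ = subst (_≤ ∑ (f ∘ suc)) (∑-const n c) (∑-mono-≤ (c≤f ∘ suc))
∑-tight {suc n} f c c≤f ∑f≤ (suc i) =
  ∑-tight (f ∘ suc) c (c≤f ∘ suc) (+-cancelˡ-≤ c _ _ (≤-trans (+-monoˡ-≤ _ (c≤f zero)) ∑f≤)) i

sum-map-mono-≤ : ∀ {A : Set} {w w′ : A → ℕ} → (∀ x → w x ≤ w′ x) →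
                 ∀ xs → sum (map w xs) ≤ sum (map w′ xs)
sum-map-mono-≤ w≤w′ []       = z≤n
sum-map-mono-≤ w≤w′ (x ∷ xs) = +-mono-≤ (w≤w′ x) (sum-map-mono-≤ w≤w′ xs)

sum-map-cong : ∀ {A : Set} {w w′ : A → ℕ} {xs} →
               All (λ x → w x ≡ w′ x) xs → sum (map w xs) ≡ sum (map w′ xs)
sum-map-cong []         = refl
sum-map-cong (wx ∷ wxs) = cong₂ _+_ wx (sum-map-cong wxs)

sum-tabulate : ∀ {n} (f : Fin n → ℕ) → sum (tabulate f) ≡ ∑ f
sum-tabulate {zero}  f = refl
sum-tabulate {suc n} f = cong (f zero +_) (sum-tabulate (f ∘ suc))

sum-allFin : ∀ {n} (f : Fin n → ℕ) → sum (map f (allFin n)) ≡ ∑ f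
sum-allFin f = trans (cong sum (map-tabulate (λ i → i) f)) (sum-tabulate f)

∑ᵀ : (b : Bool) → (T b → ℕ) → ℕ
∑ᵀ true  h = h _
∑ᵀ false h = 0

∑ᵀ-cong : ∀ {b} {h h′ : T b → ℕ} → (∀ p → h p ≡ h′ p) → ∑ᵀ b h ≡ ∑ᵀ b h′
∑ᵀ-cong {b = true}  h≡h′ = h≡h′ _
∑ᵀ-cong {b = false} h≡h′ = refl

∑ᵀ-zero : ∀ {b} {h : T b → ℕ} → (∀ p → h p ≡ 0) → ∑ᵀ b h ≡ 0
∑ᵀ-zero {b = true}  h≡0 = h≡0 _
∑ᵀ-zero {b = false} h≡0 = refl

∑ᵀ-at : ∀ {b} (h : T b → ℕ) (p : T b) → ∑ᵀ b h ≡ h p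
∑ᵀ-at {b = true} h p = refl

∑ᵀ-const : ∀ {b} c → ∑ᵀ b (λ _ → c) ≡ (if b then c else 0)
∑ᵀ-const {b = true}  c = refl
∑ᵀ-const {b = false} c = refl

∑ᵀ-∑ : ∀ {b n} (h : T b → Fin n → ℕ) → ∑ᵀ b (λ p → ∑ (h p)) ≡ ∑[ i < n ] ∑ᵀ b (λ p → h p i)
∑ᵀ-∑ {b = true}  h = refl
∑ᵀ-∑ {b = false} {n} h = ≡.sym (∑-zero {n} λ _ → refl)

module Darts (G : Graph) where

  dart-≡ : {d d′ : Dart G} → tail {G} d ≡ tail {G} d′ → head {G} d ≡ head {G} d′ → d ≡ d′
  dart-≡ {u , v , p} {u , v , p′} refl refl = cong (λ q → u , v , q) (T-irrelevant p p′)

  _≟ᴰ_ : DecidableEquality (Dart G)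
  _≟ᴰ_ = ≡-dec _≟_ (≡-dec _≟_ λ p q → yes (T-irrelevant p q))

  ∑ᴰ : (Dart G → ℕ) → ℕ
  ∑ᴰ w = ∑[ u < N G ] ∑[ v < N G ] ∑ᵀ (adj G u v) (λ p → w (u , v , p))

  numDarts≡∑ᴰ : numDarts G ≡ ∑ᴰ (λ _ → 1)
  numDarts≡∑ᴰ = trans (sum-allFin row) (sum-cong-≗ λ u →
    trans (sum-allFin (cell u)) (sum-cong-≗ λ v → ≡.sym (∑ᵀ-const {adj G u v} 1)))
    where
    cell : Fin (N G) → Fin (N G) → ℕ
    cell u v = if adj G u v then 1 else 0
    row : Fin (N G) → ℕ
    row u = sum (map (cell u) (allFin (N G)))

  ∑ᴰ-cong : {w w′ : Dart G → ℕ} → (∀ d → w d ≡ w′ d) → ∑ᴰ w ≡ ∑ᴰ w′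
  ∑ᴰ-cong w≡w′ = sum-cong-≗ λ u → sum-cong-≗ λ v → ∑ᵀ-cong {adj G u v} λ p → w≡w′ (u , v , p)

  ∑ᴰ-zero : {w : Dart G → ℕ} → (∀ d → w d ≡ 0) → ∑ᴰ w ≡ 0
  ∑ᴰ-zero w≡0 = ∑-zero {N G} λ u → ∑-zero {N G} λ v → ∑ᵀ-zero {adj G u v} λ p → w≡0 (u , v , p)

  ∑ᴰ-∑ : ∀ {n} (g : Dart G → Fin n → ℕ) → ∑ᴰ (λ d → ∑ (g d)) ≡ ∑[ i < n ] ∑ᴰ (λ d → g d i)
  ∑ᴰ-∑ {n} g = begin
    ∑ᴰ (λ d → ∑ (g d))
      ≡⟨ (sum-cong-≗ λ u → sum-cong-≗ λ v → ∑ᵀ-∑ λ p → g (u , v , p)) ⟩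
    ∑[ u < N G ] ∑[ v < N G ] ∑[ i < n ] ∑ᵀ (adj G u v) (λ p → g (u , v , p) i)
      ≡⟨ (sum-cong-≗ λ u → ∑-comm λ v i → ∑ᵀ (adj G u v) (λ p → g (u , v , p) i)) ⟩
    ∑[ u < N G ] ∑[ i < n ] ∑[ v < N G ] ∑ᵀ (adj G u v) (λ p → g (u , v , p) i)
      ≡⟨ ∑-comm (λ u i → ∑[ v < N G ] ∑ᵀ (adj G u v) (λ p → g (u , v , p) i)) ⟩
    ∑[ i < n ] ∑ᴰ (λ d → g d i) ∎
    where open ≡-Reasoning

  infixl 6 _∖_
  _∖_ : (Dart G → ℕ) → Dart G → Dart G → ℕ
  (w ∖ y) x = if ⌊ x ≟ᴰ y ⌋ then 0 else w x

  ∖-off : ∀ w y {x} → x ≢ y → (w ∖ y) x ≡ w x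
  ∖-off w y {x} x≢y = cong (if_then 0 else w x) (⌊⌋-false (x ≟ᴰ y) x≢y)

  ∖-≤ : ∀ w y x → (w ∖ y) x ≤ w x
  ∖-≤ w y x with x ≟ᴰ y
  ... | yes _ = z≤n
  ... | no  _ = ≤-refl

  ∑ᴰ-remove : ∀ w y → ∑ᴰ w ≡ w y + ∑ᴰ (w ∖ y)
  ∑ᴰ-remove w y@(u₀ , v₀ , p₀) = +-cancelʳ-≡ (row′ u₀) _ _ (begin
    ∑ row + row′ u₀         ≡⟨ ∑-exchange u₀ rows-agree ⟩
    row u₀ + ∑ row′         ≡⟨ cong (_+ ∑ row′) row-u₀ ⟩
    w y + row′ u₀ + ∑ row′  ≡⟨ xy∙z≈xz∙y (w y) (row′ u₀) (∑ row′) ⟩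
    w y + ∑ row′ + row′ u₀  ∎)
    where
    open ≡-Reasoning
    cell cell′ : Fin (N G) → Fin (N G) → ℕ
    cell  u v = ∑ᵀ (adj G u v) (λ p → w (u , v , p))
    cell′ u v = ∑ᵀ (adj G u v) (λ p → (w ∖ y) (u , v , p))
    row row′ : Fin (N G) → ℕ
    row  u = ∑ (cell u)
    row′ u = ∑ (cell′ u)
    rows-agree : ∀ u → u ≢ u₀ → row u ≡ row′ u
    rows-agree u u≢u₀ = sum-cong-≗ λ v → ∑ᵀ-cong {adj G u v} λ p →
      ≡.sym (∖-off w y (u≢u₀ ∘ cong (tail {G})))
    cells-agree : ∀ v → v ≢ v₀ → cell u₀ v ≡ cell′ u₀ v
    cells-agree v v≢v₀ = ∑ᵀ-cong {adj G u₀ v} λ p → ≡.sym (∖-off w y (v≢v₀ ∘ cong (head {G})))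
    cell′-at-y : cell′ u₀ v₀ ≡ 0
    cell′-at-y = trans (∑ᵀ-at _ p₀) (cong (if_then 0 else w y) (⌊⌋-true (y ≟ᴰ y) refl))
    row-u₀ : row u₀ ≡ w y + row′ u₀
    row-u₀ = begin
      row u₀                       ≡⟨ +-identityʳ _ ⟨
      row u₀ + 0                   ≡⟨ cong (row u₀ +_) cell′-at-y ⟨
      row u₀ + cell′ u₀ v₀         ≡⟨ ∑-exchange v₀ cells-agree ⟩
      cell u₀ v₀ + row′ u₀         ≡⟨ cong (_+ row′ u₀) (∑ᵀ-at _ p₀) ⟩
      w y + row′ u₀                ∎

  ∑ᴰ-unique-≤ : ∀ {w xs} → Unique xs → sum (map w xs) ≤ ∑ᴰ w
  ∑ᴰ-unique-≤ {w} {[]}     AllPairs.[]             = z≤n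
  ∑ᴰ-unique-≤ {w} {y ∷ xs} (y∉xs AllPairs.∷ !xs) = begin
    w y + sum (map w xs)        ≡⟨ cong (w y +_) (sum-map-cong (All.map off-y y∉xs)) ⟩
    w y + sum (map (w ∖ y) xs)  ≤⟨ +-monoʳ-≤ (w y) (∑ᴰ-unique-≤ !xs) ⟩
    w y + ∑ᴰ (w ∖ y)            ≡⟨ ∑ᴰ-remove w y ⟨
    ∑ᴰ w                        ∎
    where
    open ≤-Reasoning
    off-y : ∀ {x} → y ≢ x → w x ≡ (w ∖ y) x
    off-y y≢x = ≡.sym (∖-off w y (y≢x ∘ ≡.sym))

  ∑ᴰ-≤-cover : ∀ {w} xs → (∀ x → x ∉ xs → w x ≡ 0) → ∑ᴰ w ≤ sum (map w xs)
  ∑ᴰ-≤-cover []       w≡0 = ≤-reflexive (∑ᴰ-zero λ x → w≡0 x λ ())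
  ∑ᴰ-≤-cover {w} (y ∷ xs) w≡0 = begin
    ∑ᴰ w                        ≡⟨ ∑ᴰ-remove w y ⟩
    w y + ∑ᴰ (w ∖ y)            ≤⟨ +-monoʳ-≤ (w y) (∑ᴰ-≤-cover xs vanishes) ⟩
    w y + sum (map (w ∖ y) xs)  ≤⟨ +-monoʳ-≤ (w y) (sum-map-mono-≤ (∖-≤ w y) xs) ⟩
    w y + sum (map w xs)        ∎
    where
    open ≤-Reasoning
    vanishes : ∀ x → x ∉ xs → (w ∖ y) x ≡ 0
    vanishes x x∉xs with x ≟ᴰ y
    ... | yes _   = refl
    ... | no x≢y = w≡0 x λ { (here x≡y) → x≢y x≡y ; (there x∈xs) → x∉xs x∈xs }

  restrictToFiber : ∀ {F} → (Dart G → Fin F) → (Dart G → ℕ) → Fin F → Dart G → ℕ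
  restrictToFiber f w i x = if ⌊ f x ≟ i ⌋ then w x else 0

  fiberWeight : ∀ {F} → (Dart G → Fin F) → (Dart G → ℕ) → Fin F → ℕ
  fiberWeight f w i = ∑ᴰ (restrictToFiber f w i)

  ∑ᴰ≡∑-fiberWeight : ∀ {F} (f : Dart G → Fin F) w → ∑ᴰ w ≡ ∑[ i < F ] fiberWeight f w i
  ∑ᴰ≡∑-fiberWeight f w =
    trans (∑ᴰ-cong λ x → ≡.sym (∑-indicator (f x) (w x))) (∑ᴰ-∑ λ x i → restrictToFiber f w i x)
  fiberWeight-≥ : ∀ {F} {f : Dart G → Fin F} {i} w {xs} →
                  Unique xs → All (λ x → f x ≡ i) xs → sum (map w xs) ≤ fiberWeight f w i
  fiberWeight-≥ {f = f} {i} w {xs} !xs fxs≡i = begin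
    sum (map w xs)          ≡⟨ sum-map-cong (All.map wᵢ≡w fxs≡i) ⟨
    sum (map wᵢ xs)         ≤⟨ ∑ᴰ-unique-≤ !xs ⟩
    fiberWeight f w i       ∎
    where
    open ≤-Reasoning
    wᵢ = restrictToFiber f w i
    wᵢ≡w : ∀ {x} → f x ≡ i → wᵢ x ≡ w x
    wᵢ≡w {x} fx≡i = cong (if_then w x else 0) (⌊⌋-true (f x ≟ i) fx≡i)

  fiberWeight-≤ : ∀ {F} {f : Dart G → Fin F} {i} w xs →
                  (∀ x → f x ≡ i → x ∈ xs) → fiberWeight f w i ≤ sum (map w xs)
  fiberWeight-≤ {f = f} {i} w xs covers = begin
    fiberWeight f w i   ≤⟨ ∑ᴰ-≤-cover xs outside ⟩
    sum (map wᵢ xs)     ≤⟨ sum-map-mono-≤ wᵢ≤w xs ⟩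
    sum (map w xs)      ∎
    where
    open ≤-Reasoning
    wᵢ = restrictToFiber f w i
    outside : ∀ x → x ∉ xs → wᵢ x ≡ 0
    outside x x∉xs = cong (if_then w x else 0) (⌊⌋-false (f x ≟ i) (x∉xs ∘ covers x))
    wᵢ≤w : ∀ x → wᵢ x ≤ w x
    wᵢ≤w x with ⌊ f x ≟ i ⌋
    ... | true  = ≤-refl
    ... | false = z≤n

  edgeDarts : Fin (N G) → Fin (N G) → List (Dart G)
  edgeDarts u v with T? (adj G u v)
  ... | yes p = (u , v , p) ∷ []
  ... | no  _ = []

  allDarts : List (Dart G)
  allDarts = concatMap (λ u → concatMap (edgeDarts u) (allFin (N G))) (allFin (N G))

  ∈-allDarts : ∀ d → d ∈ allDarts
  ∈-allDarts (u , v , p) =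
    ∈-concatMap⁺ _ (lose (∈-allFin u) (∈-concatMap⁺ (edgeDarts u) (lose (∈-allFin v) ∈-edgeDarts)))
    where
    ∈-edgeDarts : (u , v , p) ∈ edgeDarts u v
    ∈-edgeDarts with T? (adj G u v)
    ... | yes q = here (cong (λ r → u , v , r) (T-irrelevant p q))
    ... | no ¬p = ⊥-elim (¬p p)

-- Orbits of a map

module Orbits {A : Set} (φ : A → A) where

  iterate-+ : ∀ j k x → iterate φ (j + k) x ≡ iterate φ j (iterate φ k x)
  iterate-+ zero    k x = refl
  iterate-+ (suc j) k x = cong φ (iterate-+ j k x)

  iterate-comm : ∀ j k x → iterate φ j (iterate φ k x) ≡ iterate φ k (iterate φ j x)
  iterate-comm j k x = begin
    iterate φ j (iterate φ k x)  ≡⟨ iterate-+ j k x ⟨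
    iterate φ (j + k) x          ≡⟨ cong (λ m → iterate φ m x) (+-comm j k) ⟩
    iterate φ (k + j) x          ≡⟨ iterate-+ k j x ⟩
    iterate φ k (iterate φ j x)  ∎
    where open ≡-Reasoning

  iterate-periodic : ∀ {p x} → iterate φ p x ≡ x → ∀ q → iterate φ (q * p) x ≡ x
  iterate-periodic         φᵖx≡x zero    = refl
  iterate-periodic {p} {x} φᵖx≡x (suc q) =
    trans (iterate-+ p (q * p) x) (trans (cong (iterate φ p) (iterate-periodic φᵖx≡x q)) φᵖx≡x)

  iterate-mod : ∀ {p x} .{{_ : NonZero p}} → iterate φ p x ≡ x →
                ∀ k → iterate φ k x ≡ iterate φ (k % p) x
  iterate-mod {p} {x} φᵖx≡x k = begin
    iterate φ k x                                     ≡⟨ cong (λ m → iterate φ m x) (m≡m%n+[m/n]*n k p) ⟩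
    iterate φ (k % p + (k / p) * p) x                 ≡⟨ iterate-+ (k % p) ((k / p) * p) x ⟩
    iterate φ (k % p) (iterate φ ((k / p) * p) x)
      ≡⟨ cong (iterate φ (k % p)) (iterate-periodic φᵖx≡x (k / p)) ⟩
    iterate φ (k % p) x                               ∎
    where open ≡-Reasoning

  segment : ℕ → A → List A
  segment k x = applyUpTo (λ j → iterate φ j x) k

  segment-all : ∀ {P : A → Set} {x} k → (∀ j → P (iterate φ j x)) → All P (segment k x)
  segment-all {x = x} k = applyUpTo⁺₂ (λ j → iterate φ j x) k

  SameOrbit : A → A → Set
  SameOrbit x y = ∃[ k ] iterate φ k x ≡ y

  segment-complete : ∀ {k x y} .{{_ : NonZero k}} → iterate φ k x ≡ x → SameOrbit x y → y ∈ segment k x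
  segment-complete {k} {x} φᵏx≡x (j , refl) =
    subst (_∈ segment k x) (≡.sym (iterate-mod φᵏx≡x j)) (∈-applyUpTo⁺ (λ j → iterate φ j x) (m%n<n j k))

  returns-along : ∀ {j k x y} → iterate φ k x ≡ y → iterate φ j x ≡ x → iterate φ j y ≡ y
  returns-along {j} {k} {x} refl φʲx≡x = trans (iterate-comm j k x) (cong (iterate φ k) φʲx≡x)

  NoReturnBefore : ℕ → A → Set
  NoReturnBefore k x = ∀ j → 0 < j → j < k → iterate φ j x ≢ x

  noReturnBefore-suc : ∀ {k x} → NoReturnBefore k x → iterate φ k x ≢ x → NoReturnBefore (suc k) x
  noReturnBefore-suc noReturn φᵏx≢x j 0<j j<1+k with m<1+n⇒m<n∨m≡n j<1+k
  ... | inj₁ j<k  = noReturn j 0<j j<k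
  ... | inj₂ refl = φᵏx≢x

  module _ (φ-injective : ∀ {x y} → φ x ≡ φ y → x ≡ y) where

    iterate-injective : ∀ k {x y} → iterate φ k x ≡ iterate φ k y → x ≡ y
    iterate-injective zero    eq = eq
    iterate-injective (suc k) eq = iterate-injective k (φ-injective eq)

    returns-back : ∀ {j k x y} → iterate φ k x ≡ y → iterate φ j y ≡ y → iterate φ j x ≡ x
    returns-back {j} {k} {x} {y} φᵏx≡y φʲy≡y = iterate-injective k (begin
      iterate φ k (iterate φ j x)  ≡⟨ iterate-comm k j x ⟩
      iterate φ j (iterate φ k x)  ≡⟨ cong (iterate φ j) φᵏx≡y ⟩
      iterate φ j y                ≡⟨ φʲy≡y ⟩
      y                            ≡⟨ φᵏx≡y ⟨
      iterate φ k x                ∎)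
      where open ≡-Reasoning

    segment-unique : ∀ {k x} → NoReturnBefore k x → Unique (segment k x)
    segment-unique {k} {x} noReturn = applyUpTo⁺₁ (λ j → iterate φ j x) k distinct
      where
      distinct : ∀ {i j} → i < j → j < k → iterate φ i x ≢ iterate φ j x
      distinct {i} {j} i<j j<k φⁱx≡φʲx =
        noReturn (j ∸ i) (m<n⇒0<n∸m i<j) (≤-<-trans (m∸n≤m j i) j<k) (iterate-injective i (begin
          iterate φ i (iterate φ (j ∸ i) x)  ≡⟨ iterate-+ i (j ∸ i) x ⟨
          iterate φ (i + (j ∸ i)) x          ≡⟨ cong (λ m → iterate φ m x) (m+[n∸m]≡n (<⇒≤ i<j)) ⟩
          iterate φ j x                      ≡⟨ φⁱx≡φʲx ⟨
          iterate φ i x                      ∎))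
        where open ≡-Reasoning

  module _ (p : ℕ) (period : ∀ x → iterate φ (suc p) x ≡ x) (_≟_ : DecidableEquality A) where

    sameOrbit-decSetoid : DecSetoid 0ℓ 0ℓ
    sameOrbit-decSetoid = record
      { Carrier          = A
      ; _≈_              = SameOrbit
      ; isDecEquivalence = record
        { isEquivalence = record { refl = 0 , refl ; sym = sameOrbit-sym ; trans = sameOrbit-trans }
        ; _≟_           = sameOrbit? } }
      where
      sameOrbit-trans : ∀ {x y z} → SameOrbit x y → SameOrbit y z → SameOrbit x z
      sameOrbit-trans {x} (j , φʲx≡y) (k , φᵏy≡z) =
        k + j , trans (iterate-+ k j x) (trans (cong (iterate φ k) φʲx≡y) φᵏy≡z)
      sameOrbit-sym : ∀ {x y} → SameOrbit x y → SameOrbit y x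
      sameOrbit-sym {x} (k , refl) = k * p , (begin
        iterate φ (k * p) (iterate φ k x)  ≡⟨ iterate-+ (k * p) k x ⟨
        iterate φ (k * p + k) x            ≡⟨ cong (λ m → iterate φ m x) k*p+k≡k*[1+p] ⟩
        iterate φ (k * suc p) x            ≡⟨ iterate-periodic (period x) k ⟩
        x                                  ∎)
        where
        open ≡-Reasoning
        k*p+k≡k*[1+p] : k * p + k ≡ k * suc p
        k*p+k≡k*[1+p] = trans (+-comm (k * p) k) (≡.sym (*-suc k p))
      sameOrbit? : ∀ x y → Dec (SameOrbit x y)
      sameOrbit? x y = Dec.map′ (λ (i , φⁱx≡y) → toℕ i , φⁱx≡y) reduce (any? λ i → iterate φ (toℕ i) x ≟ y)
        where
        reduce : SameOrbit x y → ∃ λ (i : Fin (suc p)) → iterate φ (toℕ i) x ≡ y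
        reduce (k , φᵏx≡y) = fromℕ< k%[1+p]<1+p , (begin
          iterate φ (toℕ (fromℕ< k%[1+p]<1+p)) x  ≡⟨ cong (λ m → iterate φ m x) (toℕ-fromℕ< k%[1+p]<1+p) ⟩
          iterate φ (k % suc p) x                ≡⟨ iterate-mod (period x) k ⟨
          iterate φ k x                          ≡⟨ φᵏx≡y ⟩
          y                                      ∎)
          where
          open ≡-Reasoning
          k%[1+p]<1+p = m%n<n k (suc p)

module _ (S : DecSetoid 0ℓ 0ℓ) where
  open DecSetoid S using (Carrier; _≈_; setoid; reflexive)
    renaming (_≟_ to _≈?_; refl to ≈-refl; sym to ≈-sym; trans to ≈-trans)
  open UniqueSetoid setoid using () renaming (Unique to Uniqueₛ)
  open Enumerates setoid using (IsEnumeration)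

  lookup-injective : ∀ {xs} → Uniqueₛ xs → ∀ i j → lookup xs i ≈ lookup xs j → i ≡ j
  lookup-injective (x≉xs AllPairs.∷ !xs) zero    zero    _  = refl
  lookup-injective (x≉xs AllPairs.∷ !xs) zero    (suc j) x≈ = ⊥-elim (All.lookup x≉xs (∈-lookup j) x≈)
  lookup-injective (x≉xs AllPairs.∷ !xs) (suc i) zero    ≈x = ⊥-elim (All.lookup x≉xs (∈-lookup i) (≈-sym ≈x))
  lookup-injective (x≉xs AllPairs.∷ !xs) (suc i) (suc j) eq = cong suc (lookup-injective !xs i j eq)

  finiteQuotient : ∀ xs → IsEnumeration xs →
    ∃[ k ] Σ[ q ∈ (Carrier → Fin k) ]
      ((∀ i → ∃[ x ] q x ≡ i) × (∀ x y → (q x ≡ q y → x ≈ y) × (x ≈ y → q x ≡ q y)))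
  finiteQuotient xs xs-enumerates = length reps , q , surjective , λ x y → reflects , preserves
    where
    reps = deduplicate _≈?_ xs
    q : Carrier → Fin (length reps)
    q x = index (deduplicate⁺ S xs-enumerates x)
    ≈rep : ∀ x → x ≈ lookup reps (q x)
    ≈rep x = lookup-index (deduplicate⁺ S xs-enumerates x)
    q-injective : ∀ {x i} → x ≈ lookup reps i → q x ≡ i
    q-injective {x} x≈ = lookup-injective (deduplicate-! S xs) (q x) _ (≈-trans (≈-sym (≈rep x)) x≈)
    surjective : ∀ i → ∃[ x ] q x ≡ i
    surjective i = lookup reps i , q-injective ≈-refl
    reflects : ∀ {x y} → q x ≡ q y → x ≈ y
    reflects {x} {y} qx≡qy =
      ≈-trans (≈rep x) (≈-trans (reflexive (cong (lookup reps) qx≡qy)) (≈-sym (≈rep y)))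
    preserves : ∀ {x y} → x ≈ y → q x ≡ q y
    preserves {x} {y} x≈y = q-injective (≈-trans x≈y (≈rep y))

module RotationFaces {S : SymGraph} (R : RotationSystem S) where
  private
    G = graph S
    φ = faceStep R
  open Darts G using (dart-≡)
  open Orbits φ using (NoReturnBefore)

  rev-involutive : ∀ d → rev S (rev S d) ≡ d
  rev-involutive d = dart-≡ refl refl

  tail-faceStep : ∀ d → tail {G} (φ d) ≡ head {G} d
  tail-faceStep d = ρ-tail R (rev S d)

  faceStep-injective : ∀ {d d′} → φ d ≡ φ d′ → d ≡ d′
  faceStep-injective {d} {d′} φd≡φd′ = begin
    d                ≡⟨ rev-involutive d ⟨
    rev S (rev S d)  ≡⟨ cong (rev S) rev-d≡rev-d′ ⟩
    rev S (rev S d′) ≡⟨ rev-involutive d′ ⟩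
    d′               ∎
    where
    open ≡-Reasoning
    rev-d≡rev-d′ : rev S d ≡ rev S d′
    rev-d≡rev-d′ = trans (≡.sym (ρ⁻¹∘ρ R _)) (trans (cong (ρ⁻¹ R) φd≡φd′) (ρ⁻¹∘ρ R _))

  faceStep≡rev : ∀ d → head {G} (φ d) ≡ tail {G} d → φ d ≡ rev S d
  faceStep≡rev d = dart-≡ (tail-faceStep d)

  module _ (loopless : ∀ x → ¬ T (adj G x x))
           (twoNeighbours : ∀ x → Σ[ y ∈ Fin (N G) ] Σ[ z ∈ Fin (N G) ]
                                    T (adj G x y) × T (adj G x z) × y ≢ z) where

    ρ-no-fixpoint : ∀ d → ρ R d ≢ d
    ρ-no-fixpoint e ρe≡e with twoNeighbours (tail {G} e)
    ... | y , z , p , q , y≢z = y≢z (trans (cong (head {G}) (at-e (_ , y , p) refl))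
                                          (≡.sym (cong (head {G}) (at-e (_ , z , q) refl))))
      where
      at-e : ∀ d → tail {G} e ≡ tail {G} d → d ≡ e
      at-e d te≡td with ρ-cyclic R e d te≡td
      ... | k , ρᵏe≡d = trans (≡.sym ρᵏe≡d)
                              (trans (cong (λ m → iterate (ρ R) m e) (≡.sym (*-identityʳ k)))
                                     (Orbits.iterate-periodic (ρ R) ρe≡e k))

    noReturnBefore3 : ∀ d → NoReturnBefore 3 d
    noReturnBefore3 d@(u , v , p) 1 _ _ φd≡d =
      loopless u (subst (λ w → T (adj G u w)) (trans (≡.sym (tail-faceStep d)) (cong (tail {G}) φd≡d)) p)
    noReturnBefore3 d 2 _ _ φ²d≡d = ρ-no-fixpoint (rev S d)
      (faceStep≡rev d (trans (≡.sym (tail-faceStep (φ d))) (cong (tail {G}) φ²d≡d)))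
    noReturnBefore3 d (suc (suc (suc _))) _ (s≤s (s≤s (s≤s ())))

-- The prism Kₙ × K₂

module PrismGraph (n : ℕ) where

  Vertex : Set
  Vertex = Fin n ⊎ Fin n

  adjᵛ : Vertex → Vertex → Bool
  adjᵛ (inj₁ a) (inj₁ b) = not ⌊ a ≟ b ⌋
  adjᵛ (inj₂ a) (inj₂ b) = not ⌊ a ≟ b ⌋
  adjᵛ (inj₁ a) (inj₂ b) = ⌊ a ≟ b ⌋
  adjᵛ (inj₂ a) (inj₁ b) = ⌊ a ≟ b ⌋

  matchᵛ : Vertex → Vertex → Bool
  matchᵛ (inj₁ a) (inj₁ b) = false
  matchᵛ (inj₂ a) (inj₂ b) = false
  matchᵛ (inj₁ a) (inj₂ b) = ⌊ a ≟ b ⌋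
  matchᵛ (inj₂ a) (inj₁ b) = ⌊ a ≟ b ⌋

  sideᵛ : Vertex → Bool
  sideᵛ (inj₁ _) = true
  sideᵛ (inj₂ _) = false

  prismAdj-splitAt : ∀ x y → prismAdj n x y ≡ adjᵛ (splitAt n x) (splitAt n y)
  prismAdj-splitAt x y with splitAt n x | splitAt n y
  ... | inj₁ a | inj₁ b = refl
  ... | inj₂ a | inj₂ b = refl
  ... | inj₁ a | inj₂ b = refl
  ... | inj₂ a | inj₁ b = refl

  isMatching-splitAt : ∀ x y → isMatching n x y ≡ matchᵛ (splitAt n x) (splitAt n y)
  isMatching-splitAt x y with splitAt n x | splitAt n y
  ... | inj₁ a | inj₁ b = refl
  ... | inj₂ a | inj₂ b = refl
  ... | inj₁ a | inj₂ b = refl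
  ... | inj₂ a | inj₁ b = refl

  adjᵛ-irrefl : ∀ s → adjᵛ s s ≡ false
  adjᵛ-irrefl (inj₁ a) = cong not (⌊⌋-true (a ≟ a) refl)
  adjᵛ-irrefl (inj₂ a) = cong not (⌊⌋-true (a ≟ a) refl)

  sideᵛ-step : ∀ s t → T (adjᵛ s t) → sideᵛ t ≡ sideᵛ s xor matchᵛ s t
  sideᵛ-step (inj₁ a) (inj₁ b) _ = refl
  sideᵛ-step (inj₂ a) (inj₂ b) _ = refl
  sideᵛ-step (inj₁ a) (inj₂ b) p rewrite ⌊⌋-true (a ≟ b) (toWitness p) = refl
  sideᵛ-step (inj₂ a) (inj₁ b) p rewrite ⌊⌋-true (a ≟ b) (toWitness p) = refl

  matchᵛ-unique : ∀ s t t′ → T (matchᵛ s t) → T (matchᵛ s t′) → t ≡ t′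
  matchᵛ-unique (inj₁ a) (inj₂ b) (inj₂ c) p q = cong inj₂ (trans (≡.sym (toWitness p)) (toWitness q))
  matchᵛ-unique (inj₂ a) (inj₁ b) (inj₁ c) p q = cong inj₁ (trans (≡.sym (toWitness p)) (toWitness q))

  matchᵛ-sym : ∀ s t → T (matchᵛ s t) → T (matchᵛ t s)
  matchᵛ-sym (inj₁ a) (inj₂ b) p = fromWitness (≡.sym (toWitness p))
  matchᵛ-sym (inj₂ a) (inj₁ b) p = fromWitness (≡.sym (toWitness p))

  otherIndex : 2 ≤ n → Fin n → Fin n
  otherIndex (s≤s (s≤s _)) zero    = suc zero
  otherIndex (s≤s (s≤s _)) (suc _) = zero

  adjᵛ-otherIndex : (2≤n : 2 ≤ n) (a : Fin n) → T (not ⌊ a ≟ otherIndex 2≤n a ⌋)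
  adjᵛ-otherIndex 2≤n a = subst (T ∘ not) (≡.sym (⌊⌋-false (a ≟ otherIndex 2≤n a) (a≢ 2≤n a))) _
    where
    a≢ : (2≤n : 2 ≤ n) (a : Fin n) → a ≢ otherIndex 2≤n a
    a≢ (s≤s (s≤s _)) zero    ()
    a≢ (s≤s (s≤s _)) (suc a) ()

  twoNeighboursᵛ : 2 ≤ n → ∀ s → Σ[ t ∈ Vertex ] Σ[ t′ ∈ Vertex ] T (adjᵛ s t) × T (adjᵛ s t′) × t ≢ t′
  twoNeighboursᵛ 2≤n (inj₁ a) =
    inj₂ a , inj₁ (otherIndex 2≤n a) , fromWitness refl , adjᵛ-otherIndex 2≤n a , λ ()
  twoNeighboursᵛ 2≤n (inj₂ a) =
    inj₁ a , inj₂ (otherIndex 2≤n a) , fromWitness refl , adjᵛ-otherIndex 2≤n a , λ ()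

  side : Fin (n + n) → Bool
  side x = sideᵛ (splitAt n x)

  splitAt-injective : ∀ {x y} → splitAt n x ≡ splitAt n y → x ≡ y
  splitAt-injective {x} {y} eq =
    trans (≡.sym (join-splitAt n n x)) (trans (cong (join n n) eq) (join-splitAt n n y))

  loopless : ∀ x → ¬ T (prismAdj n x x)
  loopless x = subst T (trans (prismAdj-splitAt x x) (adjᵛ-irrefl (splitAt n x)))

  side-step : ∀ {x y} → T (prismAdj n x y) → side y ≡ side x xor isMatching n x y
  side-step {x} {y} p = trans (sideᵛ-step (splitAt n x) (splitAt n y) (subst T (prismAdj-splitAt x y) p))
                              (cong (side x xor_) (≡.sym (isMatching-splitAt x y)))

  matching-unique : ∀ {x y z} → T (isMatching n x y) → T (isMatching n x z) → y ≡ z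
  matching-unique {x} {y} {z} p q = splitAt-injective (matchᵛ-unique (splitAt n x) (splitAt n y) (splitAt n z)
    (subst T (isMatching-splitAt x y) p) (subst T (isMatching-splitAt x z) q))

  matching-sym : ∀ {x y} → T (isMatching n x y) → T (isMatching n y x)
  matching-sym {x} {y} p = subst T (≡.sym (isMatching-splitAt y x))
    (matchᵛ-sym (splitAt n x) (splitAt n y) (subst T (isMatching-splitAt x y) p))

  twoNeighbours : 2 ≤ n → ∀ x → Σ[ y ∈ Fin (n + n) ] Σ[ z ∈ Fin (n + n) ]
                                  T (prismAdj n x y) × T (prismAdj n x z) × y ≢ z
  twoNeighbours 2≤n x with twoNeighboursᵛ 2≤n (splitAt n x)
  ... | t , t′ , p , p′ , t≢t′ =
    join n n t , join n n t′ , adj-join p , adj-join p′ ,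
    λ eq → t≢t′ (trans (≡.sym (splitAt-join n n t)) (trans (cong (splitAt n) eq) (splitAt-join n n t′)))
    where
    adj-join : ∀ {t} → T (adjᵛ (splitAt n x) t) → T (prismAdj n x (join n n t))
    adj-join {t} = subst T (≡.sym (trans (prismAdj-splitAt x (join n n t))
                                         (cong (adjᵛ (splitAt n x)) (splitAt-join n n t))))

  cellᵛ : (Bool → ℕ) → Vertex → Vertex → ℕ
  cellᵛ h s t = if adjᵛ s t then h (matchᵛ s t) else 0

  module Row (h : Bool → ℕ) where
    same cross : Fin n → ℕ
    same  a = ∑[ b < n ] (if not ⌊ a ≟ b ⌋ then h false else 0)
    cross a = ∑[ b < n ] (if ⌊ a ≟ b ⌋ then h ⌊ a ≟ b ⌋ else 0)

    row : ∀ a → same a + cross a + h false ≡ n * h false + h true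
    row a = begin
      same a + cross a + h false  ≡⟨ xy∙z≈xz∙y (same a) (cross a) (h false) ⟩
      same a + h false + cross a  ≡⟨ cong₂ _+_ (∑-≟ a (λ x → if not x then h false else 0)) cross≡ ⟩
      n * h false + h true        ∎
      where
      open ≡-Reasoning
      cross≡ : cross a ≡ h true
      cross≡ = begin
        cross a          ≡⟨ +-identityʳ (cross a) ⟨
        cross a + 0      ≡⟨ ∑-≟ a (λ x → if x then h x else 0) ⟩
        h true + n * 0   ≡⟨ cong (h true +_) (*-zeroʳ n) ⟩
        h true + 0       ≡⟨ +-identityʳ (h true) ⟩
        h true           ∎

  rowᵛ : ∀ h s → ∑[ b < n ] cellᵛ h s (inj₁ b) + ∑[ b < n ] cellᵛ h s (inj₂ b) + h false
                 ≡ n * h false + h true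
  rowᵛ h (inj₁ a) = row a
    where open Row h
  rowᵛ h (inj₂ a) = trans (cong (_+ h false) (+-comm (cross a) (same a))) (row a)
    where open Row h

  module _ where
    open Darts (graph (Prism n)) using (∑ᴰ)

    ∑ᴰ-byMatching : ∀ (h : Bool → ℕ) →
      ∑ᴰ (λ d → h (isMatching n (tail {graph (Prism n)} d) (head {graph (Prism n)} d))) + (n + n) * h false
        ≡ (n + n) * (n * h false + h true)
    ∑ᴰ-byMatching h = begin
      ∑ row + (n + n) * h false                ≡⟨ cong (∑ row +_) (∑-const (n + n) (h false)) ⟨
      ∑ row + ∑[ u < n + n ] h false           ≡⟨ ∑-distrib-+ row (λ _ → h false) ⟨
      ∑[ u < n + n ] (row u + h false)         ≡⟨ sum-cong-≗ row+h≡ ⟩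
      ∑[ u < n + n ] (n * h false + h true)    ≡⟨ ∑-const (n + n) _ ⟩
      (n + n) * (n * h false + h true)         ∎
      where
      open ≡-Reasoning
      row : Fin (n + n) → ℕ
      row u = ∑[ v < n + n ] ∑ᵀ (prismAdj n u v) (λ _ → h (isMatching n u v))
      row+h≡ : ∀ u → row u + h false ≡ n * h false + h true
      row+h≡ u = trans (cong (_+ h false) row≡) (rowᵛ h (splitAt n u))
        where
        s = splitAt n u
        row≡ : row u ≡ ∑[ b < n ] cellᵛ h s (inj₁ b) + ∑[ b < n ] cellᵛ h s (inj₂ b)
        row≡ = begin
          row u
            ≡⟨ (sum-cong-≗ λ v → trans (∑ᵀ-const {prismAdj n u v} _)
                 (cong₂ (λ a m → if a then h m else 0) (prismAdj-splitAt u v) (isMatching-splitAt u v))) ⟩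
          ∑[ v < n + n ] cellᵛ h s (splitAt n v)
            ≡⟨ ∑-+ n n (λ v → cellᵛ h s (splitAt n v)) ⟩
          ∑[ b < n ] cellᵛ h s (splitAt n (b ↑ˡ n)) + ∑[ b < n ] cellᵛ h s (splitAt n (n ↑ʳ b))
            ≡⟨ cong₂ _+_ (sum-cong-≗ λ b → cong (cellᵛ h s) (splitAt-↑ˡ n b n))
                         (sum-cong-≗ λ b → cong (cellᵛ h s) (splitAt-↑ʳ n n b)) ⟩
          ∑[ b < n ] cellᵛ h s (inj₁ b) + ∑[ b < n ] cellᵛ h s (inj₂ b)
            ∎

edgeWeight : Bool → ℕ
edgeWeight true  = 1
edgeWeight false = 2

edgeWeight-≥1 : ∀ b → 1 ≤ edgeWeight b
edgeWeight-≥1 true  = s≤s z≤n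
edgeWeight-≥1 false = s≤s z≤n

-- The bᵢ are the matching bits of consecutive darts along a face walk.
matchingRun-≥6 : ∀ {b₀ b₁ b₂ b₃} k → T b₀ → ¬ T b₁ → (T b₂ → ¬ T b₃) →
  6 + k ≤ edgeWeight b₀ + (edgeWeight b₁ + (edgeWeight b₂ + (edgeWeight b₃ + k)))
matchingRun-≥6 {true} {true}          k _ ¬b₁ _  = ⊥-elim (¬b₁ _)
matchingRun-≥6 {true} {false} {true}  {true}  k _ _ b₂⇒¬b₃ = ⊥-elim (b₂⇒¬b₃ _ _)
matchingRun-≥6 {true} {false} {true}  {false} k _ _ _ = ≤-refl
matchingRun-≥6 {true} {false} {false} {true}  k _ _ _ = ≤-refl
matchingRun-≥6 {true} {false} {false} {false} k _ _ _ = n≤1+n (6 + k)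

plainRun : ∀ {b₀ b₁ b₂} k → ¬ T b₀ → ¬ T b₁ → ¬ T b₂ →
  edgeWeight b₀ + (edgeWeight b₁ + (edgeWeight b₂ + k)) ≡ 6 + k
plainRun {false} {false} {false} k _ _ _ = refl
plainRun {true}                  k ¬b₀ _ _ = ⊥-elim (¬b₀ _)
plainRun {false} {true}          k _ ¬b₁ _ = ⊥-elim (¬b₁ _)
plainRun {false} {false} {true}  k _ _ ¬b₂ = ⊥-elim (¬b₂ _)

quadrilateralRun : ∀ {b₀ b₁ b₂ b₃} → T b₀ → ¬ T b₁ → (T b₂ → ¬ T b₃) →
  b₀ xor (b₁ xor (b₂ xor (b₃ xor false))) ≡ false →
  edgeWeight b₀ + (edgeWeight b₁ + (edgeWeight b₂ + (edgeWeight b₃ + 0))) ≡ 6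
quadrilateralRun {true} {true}                  _ ¬b₁ _ _ = ⊥-elim (¬b₁ _)
quadrilateralRun {true} {false} {true}  {true}  _ _ b₂⇒¬b₃ _ = ⊥-elim (b₂⇒¬b₃ _ _)
quadrilateralRun {true} {false} {true}  {false} _ _ _ _ = refl
quadrilateralRun {true} {false} {false} {true}  _ _ _ _ = refl
quadrilateralRun {true} {false} {false} {false} _ _ _ ()

triangleRun : ∀ {b₀ b₁ b₂} → T b₀ → ¬ T b₁ → (T b₂ → ¬ T b₀) → b₀ xor (b₁ xor (b₂ xor false)) ≢ false
triangleRun {true} {true}          _ ¬b₁ _      _  = ¬b₁ _
triangleRun {true} {false} {true}  _ _  b₂⇒¬b₀ _  = b₂⇒¬b₀ _ _
triangleRun {true} {false} {false} _ _  _      ()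

xor-cancel : ∀ s c → s xor c ≡ s → c ≡ false
xor-cancel true  false _ = refl
xor-cancel false false _ = refl

dartWeight : (n : ℕ) → Dart (graph (Prism n)) → ℕ
dartWeight n d = edgeWeight (isMatching n (tail {graph (Prism n)} d) (head {graph (Prism n)} d))

totalWeight : ℕ → ℕ
totalWeight n = Darts.∑ᴰ (graph (Prism n)) (dartWeight n)

module _ (n : ℕ) where
  open Darts (graph (Prism n)) using (∑ᴰ; numDarts≡∑ᴰ)
  open PrismGraph n using (∑ᴰ-byMatching)

  numDarts-Prism : numDarts (graph (Prism n)) ≡ (n + n) * n
  numDarts-Prism = +-cancelʳ-≡ ((n + n) * 1) _ _ (begin
    numDarts (graph (Prism n)) + (n + n) * 1  ≡⟨ cong (_+ (n + n) * 1) numDarts≡∑ᴰ ⟩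
    ∑ᴰ (λ _ → 1) + (n + n) * 1               ≡⟨ ∑ᴰ-byMatching (λ _ → 1) ⟩
    (n + n) * (n * 1 + 1)                    ≡⟨ expand n ⟩
    (n + n) * n + (n + n) * 1                ∎)
    where
    open ≡-Reasoning
    expand : ∀ n → (n + n) * (n * 1 + 1) ≡ (n + n) * n + (n + n) * 1
    expand = solve-∀

  totalWeight-Prism : totalWeight n + (n + n) ≡ (n + n) * (n + n)
  totalWeight-Prism = +-cancelʳ-≡ (n + n) _ _ (begin
    W + (n + n) + (n + n)      ≡⟨ +-assoc W (n + n) (n + n) ⟩
    W + ((n + n) + (n + n))    ≡⟨ cong (W +_) (double n) ⟩
    W + (n + n) * 2            ≡⟨ ∑ᴰ-byMatching edgeWeight ⟩
    (n + n) * (n * 2 + 1)      ≡⟨ expand n ⟩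
    (n + n) * (n + n) + (n + n) ∎)
    where
    open ≡-Reasoning
    W = totalWeight n
    double : ∀ n → (n + n) + (n + n) ≡ (n + n) * 2
    double = solve-∀
    expand : ∀ n → (n + n) * (n * 2 + 1) ≡ (n + n) * (n + n) + (n + n)
    expand = solve-∀

-- Faces of embeddings of the prism

module PrismFaces {n : ℕ} (2≤n : 2 ≤ n) (R : RotationSystem (Prism n)) where
  private
    G = graph (Prism n)
    φ = faceStep R
  open Darts G using (_≟ᴰ_; allDarts; ∈-allDarts)
  open Orbits φ
  open RotationFaces R
  open PrismGraph n using (side; side-step; matching-unique; matching-sym; loopless; twoNeighbours)

  matching : Dart G → Bool
  matching d = isMatching n (tail {G} d) (head {G} d)

  noShortReturn : ∀ d → NoReturnBefore 3 d
  noShortReturn = noReturnBefore3 loopless (twoNeighbours 2≤n)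

  matching-not-consecutive : ∀ d → T (matching d) → ¬ T (matching (φ d))
  matching-not-consecutive d m m′ =
    ρ-no-fixpoint loopless (twoNeighbours 2≤n) (rev (Prism n) d) (faceStep≡rev d head-φd≡tail-d)
    where
    head-φd≡tail-d : head {G} (φ d) ≡ tail {G} d
    head-φd≡tail-d = matching-unique
      (subst (λ x → T (isMatching n x (head {G} (φ d)))) (tail-faceStep d) m′) (matching-sym m)

  crossings : ℕ → Dart G → Bool
  crossings zero    d = false
  crossings (suc k) d = matching d xor crossings k (φ d)

  side-iterate : ∀ k d → side (tail {G} (iterate φ k d)) ≡ side (tail {G} d) xor crossings k d
  side-iterate zero    d = ≡.sym (xor-identityʳ _)
  side-iterate (suc k) d = begin
    side (tail {G} (φ (iterate φ k d)))                         ≡⟨ cong (side ∘ tail {G}) (iterate-comm k 1 d) ⟨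
    side (tail {G} (iterate φ k (φ d)))                         ≡⟨ side-iterate k (φ d) ⟩
    side (tail {G} (φ d)) xor crossings k (φ d)                 ≡⟨ cong (_xor crossings k (φ d)) side-φd ⟩
    (side (tail {G} d) xor matching d) xor crossings k (φ d)    ≡⟨ xor-assoc (side (tail {G} d)) _ _ ⟩
    side (tail {G} d) xor crossings (suc k) d                   ∎
    where
    open ≡-Reasoning
    side-φd : side (tail {G} (φ d)) ≡ side (tail {G} d) xor matching d
    side-φd = trans (cong side (tail-faceStep d)) (side-step (proj₂ (proj₂ d)))

  crossings-closed : ∀ k d → iterate φ k d ≡ d → crossings k d ≡ false
  crossings-closed k d φᵏd≡d = xor-cancel (side (tail {G} d)) (crossings k d)
    (trans (≡.sym (side-iterate k d)) (cong (side ∘ tail {G}) φᵏd≡d))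

  triangle-no-matching : ∀ e → iterate φ 3 e ≡ e → ¬ T (matching e)
  triangle-no-matching e φ³e≡e m = triangleRun m (matching-not-consecutive e m)
    (λ m₂ → matching-not-consecutive (φ (φ e)) m₂ ∘ subst (T ∘ matching) (≡.sym φ³e≡e))
    (crossings-closed 3 e φ³e≡e)

  segmentWeight : ℕ → Dart G → ℕ
  segmentWeight k d = sum (map (dartWeight n) (segment k d))

  quadrilateral-weight : ∀ e → iterate φ 4 e ≡ e → T (matching e) → segmentWeight 4 e ≡ 6
  quadrilateral-weight e φ⁴e≡e m = quadrilateralRun m (matching-not-consecutive e m)
    (matching-not-consecutive (φ (φ e))) (crossings-closed 4 e φ⁴e≡e)

  matching-segment-≥6 : ∀ e → T (matching e) → 6 ≤ segmentWeight 4 e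
  matching-segment-≥6 e m =
    matchingRun-≥6 0 m (matching-not-consecutive e m) (matching-not-consecutive (φ (φ e)))

  matching-segment-≥7 : ∀ e → T (matching e) → 7 ≤ segmentWeight 5 e
  matching-segment-≥7 e m = ≤-trans (+-monoʳ-≤ 6 (≤-trans (edgeWeight-≥1 _) (m≤m+n _ 0)))
    (matchingRun-≥6 _ m (matching-not-consecutive e m) (matching-not-consecutive (φ (φ e))))

  Plain : Dart G → Set
  Plain d = All (λ x → ¬ T (matching x)) (segment 3 d)

  plain-segment : ∀ {d} → Plain d → segmentWeight 3 d ≡ 6
  plain-segment (¬m₀ ∷ ¬m₁ ∷ ¬m₂ ∷ []) = plainRun 0 ¬m₀ ¬m₁ ¬m₂

  plain-segment-≥7 : ∀ {d} → Plain d → 7 ≤ segmentWeight 4 d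
  plain-segment-≥7 (¬m₀ ∷ ¬m₁ ∷ ¬m₂ ∷ []) = ≤-trans (+-monoʳ-≤ 6 (≤-trans (edgeWeight-≥1 _) (m≤m+n _ 0)))
    (≤-reflexive (≡.sym (plainRun _ ¬m₀ ¬m₁ ¬m₂)))

  matching-or-plain : ∀ d → FaceHasMatching n R d ⊎ Plain d
  matching-or-plain d with T? (matching d) | T? (matching (φ d)) | T? (matching (φ (φ d)))
  ... | yes m₀ | _      | _      = inj₁ (d , (0 , refl) , m₀)
  ... | no _   | yes m₁ | _      = inj₁ (φ d , (1 , refl) , m₁)
  ... | no _   | no _   | yes m₂ = inj₁ (φ (φ d) , (2 , refl) , m₂)
  ... | no ¬m₀ | no ¬m₁ | no ¬m₂ = inj₂ (¬m₀ ∷ ¬m₁ ∷ ¬m₂ ∷ [])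

  faceHasMatching? : ∀ {k d} .{{_ : NonZero k}} → iterate φ k d ≡ d → Dec (FaceHasMatching n R d)
  faceHasMatching? {k} {d} φᵏd≡d = Dec.map′ fromAny toAny (Any.any? (T? ∘ matching) (segment k d))
    where
    fromAny : Any (T ∘ matching) (segment k d) → FaceHasMatching n R d
    fromAny any with applyUpTo⁻ (λ j → iterate φ j d) any
    ... | j , _ , m = iterate φ j d , (j , refl) , m
    toAny : FaceHasMatching n R d → Any (T ∘ matching) (segment k d)
    toAny (e , d~e , m) = lose (segment-complete φᵏd≡d d~e) m

  SnugAt : Dart G → Set
  SnugAt d = (FaceHasMatching n R d → FaceSize R d 4) × (¬ FaceHasMatching n R d → FaceSize R d 3)

  snugAt-period : ∀ {d} → SnugAt d → iterate φ 3 d ≡ d ⊎ (FaceHasMatching n R d × iterate φ 4 d ≡ d)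
  snugAt-period {d} (size4 , size3) = byCases (iterate φ 3 d ≟ᴰ d)
    where
    byCases : Dec (iterate φ 3 d ≡ d) → iterate φ 3 d ≡ d ⊎ (FaceHasMatching n R d × iterate φ 4 d ≡ d)
    byCases (yes φ³d≡d) = inj₁ φ³d≡d
    byCases (no  φ³d≢d) = inj₂ (decidable-stable (faceHasMatching? {4} {d} φ⁴d≡d) ¬¬matching , φ⁴d≡d)
      where
      ¬¬matching : ¬ ¬ FaceHasMatching n R d
      ¬¬matching ¬matching = φ³d≢d (proj₁ (proj₂ (size3 ¬matching)))
      φ⁴d≡d : iterate φ 4 d ≡ d
      φ⁴d≡d = decidable-stable (iterate φ 4 d ≟ᴰ d)
        λ φ⁴d≢d → ¬¬matching λ matching → φ⁴d≢d (proj₁ (proj₂ (size4 matching)))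

  -- Every face has length 3 or 4, so φ¹² = id and lying on the same face is a decidable equivalence.
  snug-faces : Snug n R → ∃[ F ] HasFaces R F
  snug-faces snug = finiteQuotient (sameOrbit-decSetoid 11 period _≟ᴰ_) allDarts
    λ d → Any.map (λ { refl → 0 , refl }) (∈-allDarts d)
    where
    period : ∀ d → iterate φ 12 d ≡ d
    period d = [ (λ φ³d≡d → iterate-periodic {3} {d} φ³d≡d 4)
               , (λ (_ , φ⁴d≡d) → iterate-periodic {4} {d} φ⁴d≡d 3) ]′ (snugAt-period (snug d))

module PrismFaceWeights {n : ℕ} (2≤n : 2 ≤ n) (R : RotationSystem (Prism n))
                        {F : ℕ} (faces : HasFaces R F) where
  private
    G = graph (Prism n)
    φ = faceStep R
    f = proj₁ faces
  open Darts G using (_≟ᴰ_; ∑ᴰ; fiberWeight; fiberWeight-≥; fiberWeight-≤; ∑ᴰ≡∑-fiberWeight)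
  open Orbits φ
  open RotationFaces R using (faceStep-injective)
  open PrismFaces 2≤n R

  faceWeight : Fin F → ℕ
  faceWeight = fiberWeight f (dartWeight n)

  f-iterate : ∀ k d → f (iterate φ k d) ≡ f d
  f-iterate k d = ≡.sym (proj₂ (proj₂ (proj₂ faces) d (iterate φ k d)) (k , refl))

  f-sameFace : ∀ {d e} → SameFace R d e → f e ≡ f d
  f-sameFace {d} (k , refl) = f-iterate k d

  segment≤faceWeight : ∀ k d → NoReturnBefore k d → segmentWeight k d ≤ faceWeight (f d)
  segment≤faceWeight k d noReturn = fiberWeight-≥ (dartWeight n)
    (segment-unique faceStep-injective {k} {d} noReturn) (segment-all k (λ j → f-iterate j d))

  faceWeight≤segment : ∀ k d .{{_ : NonZero k}} → iterate φ k d ≡ d →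
                       faceWeight (f d) ≤ segmentWeight k d
  faceWeight≤segment k d φᵏd≡d = fiberWeight-≤ (dartWeight n) (segment k d) λ x fx≡fd →
    segment-complete {k} {d} {x} φᵏd≡d (proj₁ (proj₂ (proj₂ faces) d x) (≡.sym fx≡fd))

  noReturnBefore4 : ∀ {d e} → SameFace R d e → T (matching e) → NoReturnBefore 4 d
  noReturnBefore4 {d} {e} (k , φᵏd≡e) m = noReturnBefore-suc {3} {d} (noShortReturn d)
    λ φ³d≡d → triangle-no-matching e (returns-along {3} {k} {d} {e} φᵏd≡e φ³d≡d) m

  6≤faceWeight : ∀ i → 6 ≤ faceWeight i
  6≤faceWeight i with proj₁ (proj₂ faces) i
  ... | d , refl = [ matchingFace , plainFace ]′ (matching-or-plain d)
    where
    matchingFace : FaceHasMatching n R d → 6 ≤ faceWeight (f d)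
    matchingFace (e , d~e , m) = subst (λ j → 6 ≤ faceWeight j) (f-sameFace d~e)
      (≤-trans (matching-segment-≥6 e m) (segment≤faceWeight 4 e (noReturnBefore4 (0 , refl) m)))
    plainFace : Plain d → 6 ≤ faceWeight (f d)
    plainFace plain =
      subst (_≤ faceWeight (f d)) (plain-segment plain) (segment≤faceWeight 3 d (noShortReturn d))

  triangle-faceWeight : ∀ {d} → iterate φ 3 d ≡ d → faceWeight (f d) ≤ 6
  triangle-faceWeight {d} φ³d≡d =
    ≤-trans (faceWeight≤segment 3 d φ³d≡d) (≤-reflexive (plain-segment plain))
    where
    plain : Plain d
    plain = segment-all 3 λ j →
      triangle-no-matching (iterate φ j d) (returns-along {3} {j} {d} refl φ³d≡d)

  quadrilateral-faceWeight : ∀ {d} → FaceHasMatching n R d → iterate φ 4 d ≡ d → faceWeight (f d) ≤ 6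
  quadrilateral-faceWeight {d} (e , d~e@(k , φᵏd≡e) , m) φ⁴d≡d =
    subst (λ j → faceWeight j ≤ 6) (f-sameFace d~e)
      (≤-trans (faceWeight≤segment 4 e φ⁴e≡e) (≤-reflexive (quadrilateral-weight e φ⁴e≡e m)))
    where
    φ⁴e≡e : iterate φ 4 e ≡ e
    φ⁴e≡e = returns-along {4} {k} {d} {e} φᵏd≡e φ⁴d≡d

  matching-snugAt : ∀ {d} → faceWeight (f d) ≤ 6 → FaceHasMatching n R d → SnugAt d
  matching-snugAt {d} ≤6 matching@(e , d~e@(k , φᵏd≡e) , m) =
    (λ _ → size4) , (λ ¬matching → contradiction matching ¬matching)
    where
    open ≤-Reasoning
    φ⁴e≡e : iterate φ 4 e ≡ e
    φ⁴e≡e = decidable-stable (iterate φ 4 e ≟ᴰ e) λ φ⁴e≢e → <-irrefl refl (begin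
      7                   ≤⟨ matching-segment-≥7 e m ⟩
      segmentWeight 5 e   ≤⟨ segment≤faceWeight 5 e
                               (noReturnBefore-suc {4} {e} (noReturnBefore4 (0 , refl) m) φ⁴e≢e) ⟩
      faceWeight (f e)    ≡⟨ cong faceWeight (f-sameFace d~e) ⟩
      faceWeight (f d)    ≤⟨ ≤6 ⟩
      6                   ∎)
    size4 : FaceSize R d 4
    size4 = s≤s z≤n , returns-back faceStep-injective {4} {k} {d} {e} φᵏd≡e φ⁴e≡e , noReturnBefore4 d~e m

  plain-snugAt : ∀ {d} → faceWeight (f d) ≤ 6 → Plain d → SnugAt d
  plain-snugAt {d} ≤6 plain = (λ matching → contradiction matching noMatching) , (λ _ → size3)
    where
    open ≤-Reasoning
    φ³d≡d : iterate φ 3 d ≡ d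
    φ³d≡d = decidable-stable (iterate φ 3 d ≟ᴰ d) λ φ³d≢d → <-irrefl refl (begin
      7                   ≤⟨ plain-segment-≥7 plain ⟩
      segmentWeight 4 d   ≤⟨ segment≤faceWeight 4 d
                               (noReturnBefore-suc {3} {d} (noShortReturn d) φ³d≢d) ⟩
      faceWeight (f d)    ≤⟨ ≤6 ⟩
      6                   ∎)
    size3 : FaceSize R d 3
    size3 = s≤s z≤n , φ³d≡d , noShortReturn d
    noMatching : ¬ FaceHasMatching n R d
    noMatching (e , d~e , m) = All.lookup plain (segment-complete {3} {d} {e} φ³d≡d d~e) m

  snugAt⇔faceWeight≤6 : ∀ d → SnugAt d ⇔ faceWeight (f d) ≤ 6
  snugAt⇔faceWeight≤6 d = mk⇔
    (λ snugAt → [ triangle-faceWeight , uncurry quadrilateral-faceWeight ]′ (snugAt-period snugAt))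
    (λ ≤6 → [ matching-snugAt ≤6 , plain-snugAt ≤6 ]′ (matching-or-plain d))

  faces-bound : F * 6 ≤ totalWeight n
  faces-bound = begin
    F * 6                      ≡⟨ ∑-const F 6 ⟨
    ∑[ i < F ] 6               ≤⟨ ∑-mono-≤ 6≤faceWeight ⟩
    ∑ faceWeight               ≡⟨ ∑ᴰ≡∑-fiberWeight f (dartWeight n) ⟨
    totalWeight n              ∎
    where open ≤-Reasoning

  snug⇔tight : Snug n R ⇔ totalWeight n ≤ F * 6
  snug⇔tight = mk⇔ tight snug
    where
    open ≤-Reasoning
    tight : Snug n R → totalWeight n ≤ F * 6
    tight snugR = begin
      totalWeight n      ≡⟨ ∑ᴰ≡∑-fiberWeight f (dartWeight n) ⟩
      ∑ faceWeight       ≤⟨ ∑-mono-≤ ≤6 ⟩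
      ∑[ i < F ] 6       ≡⟨ ∑-const F 6 ⟩
      F * 6              ∎
      where
      ≤6 : ∀ i → faceWeight i ≤ 6
      ≤6 i with proj₁ (proj₂ faces) i
      ... | d , refl = Equivalence.to (snugAt⇔faceWeight≤6 d) (snugR d)
    snug : totalWeight n ≤ F * 6 → Snug n R
    snug ∑≤ d = Equivalence.from (snugAt⇔faceWeight≤6 d)
      (∑-tight faceWeight 6 6≤faceWeight (subst (_≤ F * 6) (∑ᴰ≡∑-fiberWeight f (dartWeight n)) ∑≤) (f d))

-- Genus arithmetic

genus-formula : ∀ {n} g → 2 ≤ n → 6 * g ≡ (n ∸ 2) * (n ∸ 3) ⇔ 6 * g + 5 * n ≡ n * n + 6
genus-formula {n} g 2≤n = mk⇔ (λ eq → trans (cong (_+ 5 * n) eq) (expand 2≤n))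
                               (λ eq → +-cancelʳ-≡ (5 * n) _ _ (trans eq (≡.sym (expand 2≤n))))
  where
  expand : ∀ {n} → 2 ≤ n → (n ∸ 2) * (n ∸ 3) + 5 * n ≡ n * n + 6
  expand {1}           (s≤s ())
  expand {2}           _ = refl
  expand {suc (suc (suc k))} _ = lemma k
    where
    lemma : ∀ k → (suc k) * k + 5 * (3 + k) ≡ (3 + k) * (3 + k) + 6
    lemma = solve-∀

-- The hypothesis excludes n ≡ 1 (mod 3); induction with step 3.
genus-integral : ∀ n → 2 ≤ n → 3 ∣ 2 * (n * n) + 2 * n → ∃[ g ] 6 * g + 5 * n ≡ n * n + 6
genus-integral 1 (s≤s ()) _
genus-integral 2 _ _    = 0 , refl
genus-integral 3 _ _    = 0 , refl
genus-integral 4 _ 3∣40 = contradiction 3∣40 (toWitnessFalse {a? = 3 ∣? 40} _)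
genus-integral (suc (suc (suc (suc (suc m))))) _ 3∣ =
  step (genus-integral (suc (suc m)) (s≤s (s≤s z≤n)) 3∣-smaller)
  where
  split : ∀ k → 2 * ((3 + k) * (3 + k)) + 2 * (3 + k) ≡ 3 * (4 * k + 8) + (2 * (k * k) + 2 * k)
  split = solve-∀
  3∣-smaller : 3 ∣ 2 * ((2 + m) * (2 + m)) + 2 * (2 + m)
  3∣-smaller = ∣m+n∣m⇒∣n (subst (3 ∣_) (split (2 + m)) 3∣) (m∣m*n (4 * (2 + m) + 8))
  grow : ∀ g m → 6 * (g + suc m) + 5 * (5 + m) ≡ 6 * g + 5 * (2 + m) + (6 * m + 21)
  grow = solve-∀
  grow′ : ∀ m → (2 + m) * (2 + m) + 6 + (6 * m + 21) ≡ (5 + m) * (5 + m) + 6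
  grow′ = solve-∀
  step : ∃[ g ] 6 * g + 5 * (2 + m) ≡ (2 + m) * (2 + m) + 6 →
         ∃[ g ] 6 * g + 5 * (5 + m) ≡ (5 + m) * (5 + m) + 6
  step (g , eq) = g + suc m , trans (grow g m) (trans (cong (_+ (6 * m + 21)) eq) (grow′ m))

module GenusArithmetic {n D T : ℕ} (D≡ : D ≡ (n + n) * n) (T+2n≡ : T + (n + n) ≡ (n + n) * (n + n)) where

  Euler : ℕ → ℕ → Set
  Euler g F = 4 * g + 2 * (n + n) + 2 * F ≡ 4 + D

  -- Three times Euler's relation, with the dart count D and the total weight T substituted.
  euler⇔balance : ∀ g F → Euler g F ⇔ 2 * (6 * g + 5 * n) + F * 6 ≡ 2 * (n * n + 6) + T
  euler⇔balance g F = mk⇔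
    (λ eq → +-cancelʳ-≡ (n + n) _ _ (trans (≡.sym (triple-lhs g F n)) (trans (cong (3 *_) eq) triple-rhs)))
    (λ eq → *-cancelˡ-≡ _ _ 3 (trans (triple-lhs g F n) (trans (cong (_+ (n + n)) eq) (≡.sym triple-rhs))))
    where
    open ≡-Reasoning
    triple-lhs : ∀ g F n → 3 * (4 * g + 2 * (n + n) + 2 * F) ≡ 2 * (6 * g + 5 * n) + F * 6 + (n + n)
    triple-lhs = solve-∀
    expand : ∀ n → 3 * (4 + (n + n) * n) ≡ 2 * (n * n + 6) + (n + n) * (n + n)
    expand = solve-∀
    triple-rhs : 3 * (4 + D) ≡ 2 * (n * n + 6) + T + (n + n)
    triple-rhs = begin
      3 * (4 + D)                                ≡⟨ cong (λ x → 3 * (4 + x)) D≡ ⟩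
      3 * (4 + (n + n) * n)                      ≡⟨ expand n ⟩
      2 * (n * n + 6) + (n + n) * (n + n)        ≡⟨ cong (2 * (n * n + 6) +_) T+2n≡ ⟨
      2 * (n * n + 6) + (T + (n + n))            ≡⟨ +-assoc (2 * (n * n + 6)) T (n + n) ⟨
      2 * (n * n + 6) + T + (n + n)              ∎

  tight-of-genus : ∀ {g F} → Euler g F → 6 * g + 5 * n ≡ n * n + 6 → F * 6 ≡ T
  tight-of-genus {g} {F} euler genus = +-cancelˡ-≡ (2 * (n * n + 6)) _ _
    (trans (cong (λ x → 2 * x + F * 6) (≡.sym genus)) (Equivalence.to (euler⇔balance g F) euler))

  euler-of-tight : ∀ {g F} → F * 6 ≡ T → 6 * g + 5 * n ≡ n * n + 6 → Euler g F
  euler-of-tight {g} {F} tight genus =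
    Equivalence.from (euler⇔balance g F) (cong₂ (λ x y → 2 * x + y) genus tight)

  genus-minimal : ∀ {g g′ F′} → 6 * g + 5 * n ≡ n * n + 6 → Euler g′ F′ → F′ * 6 ≤ T → g ≤ g′
  genus-minimal {g} {g′} {F′} genus euler′ F′6≤T =
    *-cancelˡ-≤ 6 (+-cancelʳ-≤ (5 * n) _ _ (subst (_≤ 6 * g′ + 5 * n) (≡.sym genus) n²+6≤))
    where
    open ≤-Reasoning
    n²+6≤ : n * n + 6 ≤ 6 * g′ + 5 * n
    n²+6≤ = *-cancelˡ-≤ 2 (+-cancelʳ-≤ (F′ * 6) _ _ (begin
      2 * (n * n + 6) + F′ * 6   ≤⟨ +-monoʳ-≤ (2 * (n * n + 6)) F′6≤T ⟩
      2 * (n * n + 6) + T        ≡⟨ Equivalence.to (euler⇔balance g′ F′) euler′ ⟨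
      2 * (6 * g′ + 5 * n) + F′ * 6 ∎))

  genus-exists : ∀ {F} → 2 ≤ n → F * 6 ≡ T → ∃[ g ] 6 * g + 5 * n ≡ n * n + 6
  genus-exists {F} 2≤n tight = genus-integral n 2≤n (divides (F + n) (*-cancelˡ-≡ _ _ 2 (begin
    2 * (2 * (n * n) + 2 * n)              ≡⟨ expand n ⟩
    (n + n) * (n + n) + 2 * (n + n)        ≡⟨ cong (_+ 2 * (n + n)) 4n²≡6F+2n ⟩
    F * 6 + (n + n) + 2 * (n + n)          ≡⟨ regroup F n ⟩
    2 * ((F + n) * 3)                      ∎)))
    where
    open ≡-Reasoning
    expand : ∀ n → 2 * (2 * (n * n) + 2 * n) ≡ (n + n) * (n + n) + 2 * (n + n)
    expand = solve-∀
    regroup : ∀ F n → F * 6 + (n + n) + 2 * (n + n) ≡ 2 * ((F + n) * 3)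
    regroup = solve-∀
    4n²≡6F+2n : (n + n) * (n + n) ≡ F * 6 + (n + n)
    4n²≡6F+2n = trans (≡.sym T+2n≡) (cong (_+ (n + n)) (≡.sym tight))

module PrismGenus {n : ℕ} (2≤n : 2 ≤ n) where
  open GenusArithmetic {n} {numDarts (graph (Prism n))} {totalWeight n}
                       (numDarts-Prism n) (totalWeight-Prism n)
  open PrismFaceWeights 2≤n using (faces-bound; snug⇔tight)

  embeddingGenus⇒snug : ∀ R g → EmbeddingGenus R g → 6 * g + 5 * n ≡ n * n + 6 → Snug n R
  embeddingGenus⇒snug R g (F , faces , euler) genus =
    Equivalence.from (snug⇔tight R faces) (≤-reflexive (≡.sym (tight-of-genus {g} {F} euler genus)))

  snug⇒embeddingGenus : ∀ R → Snug n R → ∃[ g ] (EmbeddingGenus R g × 6 * g + 5 * n ≡ n * n + 6)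
  snug⇒embeddingGenus R snug = g , (F , faces , euler-of-tight {g} {F} tight genus) , genus
    where
    F : ℕ
    F = proj₁ (PrismFaces.snug-faces 2≤n R snug)
    faces : HasFaces R F
    faces = proj₂ (PrismFaces.snug-faces 2≤n R snug)
    tight : F * 6 ≡ totalWeight n
    tight = ≤-antisym (faces-bound R faces) (Equivalence.to (snug⇔tight R faces) snug)
    g : ℕ
    g = proj₁ (genus-exists {F} 2≤n tight)
    genus : 6 * g + 5 * n ≡ n * n + 6
    genus = proj₂ (genus-exists {F} 2≤n tight)

  genus-lower-bound : ∀ {g} → 6 * g + 5 * n ≡ n * n + 6 → ∀ R g′ → EmbeddingGenus R g′ → g ≤ g′
  genus-lower-bound {g} genus R g′ (F , faces , euler) =
    genus-minimal {g} {g′} {F} genus euler (faces-bound R faces)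

corollary2p1 : (n : ℕ) → 2 ≤ n →
    (∃[ g ] (IsGenus (Prism n) g × 6 * g ≡ (n ∸ 2) * (n ∸ 3)))
      ⇔ (Σ[ R ∈ RotationSystem (Prism n) ] Snug n R)
corollary2p1 n 2≤n = mk⇔ genus⇒snug snug⇒genus
  where
  open PrismGenus 2≤n

  genus⇒snug : ∃[ g ] (IsGenus (Prism n) g × 6 * g ≡ (n ∸ 2) * (n ∸ 3)) →
               Σ[ R ∈ RotationSystem (Prism n) ] Snug n R
  genus⇒snug (g , ((R , embedding) , _) , genus) =
    R , embeddingGenus⇒snug R g embedding (Equivalence.to (genus-formula g 2≤n) genus)

  snug⇒genus : Σ[ R ∈ RotationSystem (Prism n) ] Snug n R →
               ∃[ g ] (IsGenus (Prism n) g × 6 * g ≡ (n ∸ 2) * (n ∸ 3))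
  snug⇒genus (R , snug) =
    let g , embedding , genus = snug⇒embeddingGenus R snug
    in  g , ((R , embedding) , genus-lower-bound genus) , Equivalence.from (genus-formula g 2≤n) genus
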